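{- Let $\mathcal L=\langle F,M,\mathrm{mng},\models\rangle$ be any logic with formula algebra $\mathfrak F$. Define, for $H\subseteq F\times F$ and $\tau,\sigma\in F$: $H\vdash_{\mathcal L}\langle\tau,\sigma\rangle$ iff for every endomorphism $f$ of $\mathfrak F$ and every $\mathfrak M\in M$, if $f(H)\subseteq\ker(\mathrm{mng}_{\mathfrak M})$ then $\langle f\tau,f\sigma\rangle\in\ker(\mathrm{mng}_{\mathfrak M})$, where $f(H)=\{\langle f\phi,f\psi\rangle:\langle\phi,\psi\rangle\in H\}$. Then: (i) $\vdash_{\mathcal L}$ is the largest substitutional and sound deductive system in $\mathcal L$ (i.e. it is substitutional and sound, and every substitutional and sound deductive system $\vdash$ in $\mathcal L$ satisfies $\vdash\subseteq\vdash_{\mathcal L}$); (ii) for all $H\subseteq F\times F$ and $\phi,\psi\in F$: $H\vdash_{\mathcal L}\langle\phi,\psi\rangle$ iff $\mathrm{Alg}_m(\mathcal L)\models\bigwedge H\to[\phi=\psi]$.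
   Context: A logic is a tuple $\mathcal L=\langle F,M,\mathrm{mng},\models\rangle$ where: $\mathrm{Cn}$ is a similarity type (the connectives) and $P$ is a set (the atomic formulas) such that no $p\in P$ is a term built by the connectives from elements of $P\setminus\{p\}$; $F$ is the universe of the term algebra $\mathfrak F=\mathfrak F(P,\mathrm{Cn})$; $M$ is a class (of models); $\models\subseteq M\times F$; and $\mathrm{mng}$ assigns to each $\mathfrak M\in M$ a homomorphism $\mathrm{mng}_{\mathfrak M}$ from $\mathfrak F$ into some algebra of type $\mathrm{Cn}$, such that $\mathrm{mng}_{\mathfrak M}(\phi)=\mathrm{mng}_{\mathfrak M}(\psi)$ and $\mathfrak M\models\phi$ imply $\mathfrak M\models\psi$. $\mathrm{Alg}_m(\mathcal L)=\{\mathrm{mng}_{\mathfrak M}(\mathfrak F):\mathfrak M\in M\}$. A (2-dimensional) deductive system in $\mathcal L$ is a consequence relation $\vdash$ (in the sense of Blok–Pigozzi) between subsets $H\subseteq F\times F$ and elements of $F\times F$. A set $\Sigma\subseteq F\times F$ is closed under $\vdash$ if $H\subseteq\Sigma$ and $H\vdash\langle\tau,\sigma\rangle$ imply $\langle\tau,\sigma\rangle\in\Sigma$. $\vdash$ is sound if $\ker(\mathrm{mng}_{\mathfrak M})$ is closed under $\vdash$ for every $\mathfrak M\in M$, and substitutional if $H\vdash\langle\tau,\sigma\rangle$ implies $f(H)\vdash\langle f\tau,f\sigma\rangle$ for every endomorphism $f$ of $\mathfrak F$. $\mathrm{Alg}_m(\mathcal L)\models\bigwedge H\to[\phi=\psi]$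 means: for every $\mathfrak A\in\mathrm{Alg}_m(\mathcal L)$ and every homomorphism $e:\mathfrak F\to\mathfrak A$ (evaluation of the atomic formulas as variables), if $e(\alpha)=e(\beta)$ for all $\langle\alpha,\beta\rangle\in H$ then $e(\phi)=e(\psi)$. -}

module Defs where

open import Data.Nat using (ℕ)
open import Data.Vec using (Vec; map)
open import Data.Product using (Σ; _×_; _,_; proj₁; proj₂)
open import Relation.Binary.PropositionalEquality using (_≡_)
open import Function.Bundles using (_⇔_)

record Signature : Set₁ where
  field
    Cn : Set
    ar : Cn → ℕ
open Signature public

data Term (S : Signature) (P : Set) : Set where
  atom : P → Term S P
  app  : (c : Cn S) → Vec (Term S P) (ar S c) → Term S P

record Algebra (S : Signature) : Set₁ where
  field
    Carrier : Set
    op      : (c : Cn S) → Vec Carrier (ar S c) → Carrier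
open Algebra public

IsHom : {S : Signature} {P : Set} (A : Algebra S) → (Term S P → Carrier A) → Set
IsHom {S} {P} A h = (c : Cn S) (ts : Vec (Term S P) (ar S c)) →
  h (app c ts) ≡ op A c (map h ts)

TermAlg : (S : Signature) (P : Set) → Algebra S
TermAlg S P = record { Carrier = Term S P ; op = app }

IsEndo : {S : Signature} {P : Set} → (Term S P → Term S P) → Set
IsEndo {S} {P} f = IsHom (TermAlg S P) f

record Logic (S : Signature) (P : Set) : Set₁ where
  field
    M       : Set
    tgt     : M → Algebra S
    mng     : (m : M) → Term S P → Carrier (tgt m)
    mng-hom : (m : M) → IsHom (tgt m) (mng m)
    _⊨_     : M → Term S P → Set
    ⊨-mng   : (m : M) (φ ψ : Term S P) → mng m φ ≡ mng m ψ → m ⊨ φ → m ⊨ ψ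
open Logic public

module _ {S : Signature} {P : Set} where

  F = Term S P

  PSet : Set₁
  PSet = F × F → Set

  _⊆_ : PSet → PSet → Set
  H ⊆ K = ∀ x → H x → K x

  Rel2 : Set₁
  Rel2 = PSet → F × F → Set

  record IsDeductiveSystem (_⊢_ : Rel2) : Set₁ where
    field
      reflex : ∀ H x → H x → H ⊢ x
      cut    : ∀ H K y → (∀ x → K x → H ⊢ x) → K ⊢ y → H ⊢ y

  image : (F → F) → PSet → PSet
  image f H x = Σ (F × F) λ p → H p × (x ≡ (f (proj₁ p) , f (proj₂ p)))

  ker : (L : Logic S P) (m : M L) → PSet
  ker L m (φ , ψ) = mng L m φ ≡ mng L m ψ

  ClosedUnder : Rel2 → PSet → Set₁
  ClosedUnder _⊢_ Σ' = ∀ H x → H ⊆ Σ' → H ⊢ x → Σ' x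

  Sound : Logic S P → Rel2 → Set₁
  Sound L _⊢_ = (m : M L) → ClosedUnder _⊢_ (ker L m)

  Substitutional : Rel2 → Set₁
  Substitutional _⊢_ = ∀ H τ σ (f : F → F) → IsEndo f →
    H ⊢ (τ , σ) → image f H ⊢ (f τ , f σ)

  _⊑_ : Rel2 → Rel2 → Set₁
  ⊢₁ ⊑ ⊢₂ = ∀ H x → ⊢₁ H x → ⊢₂ H x

  ⊢[_] : Logic S P → Rel2
  ⊢[ L ] H (τ , σ) = (f : F → F) → IsEndo f → (m : M L) →
    image f H ⊆ ker L m → ker L m (f τ , f σ)

  -- The members of Alg_m(L) are the images
  -- mng_𝔐(𝔉) ⊆ tgt 𝔐 (subalgebras); a homomorphism e : 𝔉 → mng_𝔐(𝔉) is
  -- represented as a homomorphism into tgt 𝔐 all of whose values lie in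
  -- the image of mng_𝔐 (equality in the subalgebra is that of tgt 𝔐).
  AlgModels : Logic S P → PSet → F → F → Set
  AlgModels L H φ ψ = (m : M L) (e : F → Carrier (tgt L m)) →
    IsHom (tgt L m) e →
    (∀ χ → Σ F λ θ → e χ ≡ mng L m θ) →
    (∀ α β → H (α , β) → e α ≡ e β) →
    e φ ≡ e ψ

-- Everything reduces to one observation: the homomorphisms 𝔉 → mng_𝔐(𝔉) are
-- exactly the composites mng_𝔐 ∘ f with f an endomorphism of 𝔉, because a
-- homomorphism with values in the image of mng_𝔐 lifts along mng_𝔐 (choose a
-- preimage for each atom).  Hence quantifying over substitutions and models
-- in ⊢_L is the same as quantifying over evaluations in Alg_m(L), which is
-- (ii); and (i) holds because a sound substitutional system can only derive
-- ⟨fτ, fσ⟩ from f(H) when it holds in every kernel containing f(H).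
module Submission where

open import Defs
open import Data.Product using (_×_; _,_; Σ; proj₁; proj₂)
open import Function using (_∘_; id)
open import Function.Bundles using (_⇔_; mk⇔)
open import Data.Vec using (Vec; []; _∷_; map)
open import Data.Vec.Properties using (map-∘; map-id)
open import Relation.Binary.PropositionalEquality
open ≡-Reasoning

module _ {S : Signature} {P : Set} where

  id-isEndo : IsEndo {S} {P} id
  id-isEndo c ts = cong (app c) (sym (map-id ts))

  ∘-isHom : (A : Algebra S) {h : Term S P → Carrier A} {f : Term S P → Term S P} →
            IsHom A h → IsEndo f → IsHom A (h ∘ f)
  ∘-isHom A {h} {f} h-hom f-endo c ts = begin
    h (f (app c ts))            ≡⟨ cong h (f-endo c ts) ⟩
    h (app c (map f ts))        ≡⟨ h-hom c (map f ts) ⟩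
    op A c (map h (map f ts))   ≡⟨ cong (op A c) (sym (map-∘ h f ts)) ⟩
    op A c (map (h ∘ f) ts)     ∎

  image-id : (H K : PSet {S} {P}) → H ⊆ K → image id H ⊆ K
  image-id H K H⊆K _ (p , Hp , refl) = H⊆K p Hp

  image-∘ : (f g : Term S P → Term S P) (H K : PSet {S} {P}) →
            image g (image f H) ⊆ K → image (g ∘ f) H ⊆ K
  image-∘ f g H K gfH⊆K _ ((a , b) , Hp , refl) =
    gfH⊆K _ ((f a , f b) , ((a , b) , Hp , refl) , refl)

  module LiftAlong (A : Algebra S)
                   (g : Term S P → Carrier A) (g-hom : IsHom A g)
                   (e : Term S P → Carrier A) (e-hom : IsHom A e)
                   (e⊆g : ∀ χ → Σ (Term S P) λ θ → e χ ≡ g θ) where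

    lift  : Term S P → Term S P
    lifts : ∀ {n} → Vec (Term S P) n → Vec (Term S P) n
    lift (atom p)   = proj₁ (e⊆g (atom p))
    lift (app c ts) = app c (lifts ts)
    lifts []       = []
    lifts (t ∷ ts) = lift t ∷ lifts ts

    lifts≡map : ∀ {n} (ts : Vec (Term S P) n) → lifts ts ≡ map lift ts
    lifts≡map []       = refl
    lifts≡map (t ∷ ts) = cong (lift t ∷_) (lifts≡map ts)

    lift-isEndo : IsEndo lift
    lift-isEndo c ts = cong (app c) (lifts≡map ts)

    g∘lift≗e  : ∀ t → g (lift t) ≡ e t
    g∘lifts≗e : ∀ {n} (ts : Vec (Term S P) n) → map g (lifts ts) ≡ map e ts
    g∘lift≗e (atom p)   = sym (proj₂ (e⊆g (atom p)))
    g∘lift≗e (app c ts) = begin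
      g (app c (lifts ts))        ≡⟨ g-hom c (lifts ts) ⟩
      op A c (map g (lifts ts))   ≡⟨ cong (op A c) (g∘lifts≗e ts) ⟩
      op A c (map e ts)           ≡⟨ sym (e-hom c ts) ⟩
      e (app c ts)                ∎
    g∘lifts≗e []       = refl
    g∘lifts≗e (t ∷ ts) = cong₂ _∷_ (g∘lift≗e t) (g∘lifts≗e ts)

module _ {S : Signature} {P : Set} (L : Logic S P) where

  ⊢-isDeductiveSystem : IsDeductiveSystem ⊢[ L ]
  ⊢-isDeductiveSystem = record { reflex = reflex ; cut = cut }
    where
    reflex : ∀ H x → H x → ⊢[ L ] H x
    reflex H x Hx f f-endo m fH⊆ker = fH⊆ker _ (x , Hx , refl)

    cut : ∀ H K y → (∀ x → K x → ⊢[ L ] H x) → ⊢[ L ] K y → ⊢[ L ] H y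
    cut H K y H⊢K K⊢y f f-endo m fH⊆ker = K⊢y f f-endo m fK⊆ker
      where
      fK⊆ker : image f K ⊆ ker L m
      fK⊆ker _ (x , Kx , refl) = H⊢K x Kx f f-endo m fH⊆ker

  ⊢-substitutional : Substitutional ⊢[ L ]
  ⊢-substitutional H τ σ f f-endo H⊢τσ g g-endo m gfH⊆ker =
    H⊢τσ (g ∘ f) (∘-isHom (TermAlg S P) g-endo f-endo) m (image-∘ f g H (ker L m) gfH⊆ker)

  ⊢-sound : Sound L ⊢[ L ]
  ⊢-sound m H x H⊆ker H⊢x = H⊢x id id-isEndo m (image-id H (ker L m) H⊆ker)

  ⊑-⊢ : ∀ (⊢ : Rel2) → Substitutional ⊢ → Sound L ⊢ → ⊢ ⊑ ⊢[ L ]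
  ⊑-⊢ ⊢ subst sound H (τ , σ) H⊢τσ f f-endo m fH⊆ker =
    sound m (image f H) (f τ , f σ) fH⊆ker (subst H τ σ f f-endo H⊢τσ)

  ⊢⇒AlgModels : ∀ H φ ψ → ⊢[ L ] H (φ , ψ) → AlgModels L H φ ψ
  ⊢⇒AlgModels H φ ψ H⊢φψ m e e-hom e⊆mng e-resp = begin
    e φ                ≡⟨ sym (g∘lift≗e φ) ⟩
    mng L m (lift φ)   ≡⟨ H⊢φψ lift lift-isEndo m liftH⊆ker ⟩
    mng L m (lift ψ)   ≡⟨ g∘lift≗e ψ ⟩
    e ψ                ∎
    where
    open LiftAlong (tgt L m) (mng L m) (mng-hom L m) e e-hom e⊆mng
    liftH⊆ker : image lift H ⊆ ker L m
    liftH⊆ker _ ((a , b) , Hab , refl) =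
      trans (g∘lift≗e a) (trans (e-resp a b Hab) (sym (g∘lift≗e b)))

  AlgModels⇒⊢ : ∀ H φ ψ → AlgModels L H φ ψ → ⊢[ L ] H (φ , ψ)
  AlgModels⇒⊢ H φ ψ H⊨φψ f f-endo m fH⊆ker =
    H⊨φψ m (mng L m ∘ f) (∘-isHom (tgt L m) (mng-hom L m) f-endo) (λ χ → f χ , refl)
      (λ a b Hab → fH⊆ker _ ((a , b) , Hab , refl))

theorem2p5 : (S : Signature) (P : Set) (L : Logic S P) →
    ((IsDeductiveSystem ⊢[ L ] × Substitutional ⊢[ L ] × Sound L ⊢[ L ]) ×
     (∀ (⊢ : Rel2) → IsDeductiveSystem ⊢ → Substitutional ⊢ → Sound L ⊢ → ⊢ ⊑ ⊢[ L ]))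
    × (∀ (H : PSet) (φ ψ : Term S P) → (⊢[ L ] H (φ , ψ) ⇔ AlgModels L H φ ψ))
theorem2p5 S P L =
  ( (⊢-isDeductiveSystem L , ⊢-substitutional L , ⊢-sound L)
  , λ ⊢ _ subst sound → ⊑-⊢ L ⊢ subst sound )
  , λ H φ ψ → mk⇔ (⊢⇒AlgModels L H φ ψ) (AlgModels⇒⊢ L H φ ψ)
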